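{- Let $q$ be a prime power, $m,n,k$ positive integers, let $\mathcal{C}$ be a nondegenerate $[n,k]_{q^m/q}$ rank-metric code and let $\mathcal{U}$ be an $[n,k]_{q^m/q}$ system associated with $\mathcal{C}$. Then $\rho_{\mathrm{rk}}(\mathcal{C}^\perp)=\rho_H((\mathcal{C}_{L_\mathcal{U}})^\perp)$, where $\mathcal{C}_{L_\mathcal{U}}$ is the projective Hamming-metric code associated with $\mathcal{C}$.
   Context: An $[n,k]_{q^m/q}$ code is a $k$-dimensional $\mathbb{F}_{q^m}$-subspace of $\mathbb{F}_{q^m}^{1\times n}$; it is nondegenerate if the columns of a generator matrix span an $n$-dimensional $\mathbb{F}_q$-space. A system associated with $\mathcal{C}$ is the $\mathbb{F}_q$-span $\mathcal{U}\le\mathbb{F}_{q^m}^k$ of the columns of a generator matrix of $\mathcal{C}$. The linear set is $L_\mathcal{U}=\{\langle u\rangle_{\mathbb{F}_{q^m}}: u\in\mathcal{U}\setminus\{0\}\}\subseteq\mathrm{PG}(k-1,q^m)$. The projective Hamming-metric code $\mathcal{C}_{L_\mathcal{U}}$ is the $[|L_\mathcal{U}|,k]_{q^m}$ code with generator matrix whose columns are one chosen vector representative of each point of $L_\mathcal{U}$ (well-defined up to Hamming equivalence). Duals are with respect to the standard bilinear form $x\cdot y=\sum_j x_jy_j$. Rank weight $\mathrm{wt}_{\mathrm{rk}}(x)=\dim_{\mathbb{F}_q}\langle x_1,\ldots,x_N\rangle_{\mathbb{F}_q}$; Hamming weight = number of nonzero coordinates. For a code $\mathcal{D}\le\mathbb{F}_{q^m}^{1\times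 N}$, $\rho_{\mathrm{rk}}(\mathcal{D})=\max_x\min_{c\in\mathcal{D}}\mathrm{wt}_{\mathrm{rk}}(x-c)$ and $\rho_H(\mathcal{D})=\max_x\min_{c\in\mathcal{D}}\mathrm{wt}_H(x-c)$, maxima over $x\in\mathbb{F}_{q^m}^{1\times N}$. -}

module Defs where

open import Level using (0ℓ)
open import Data.Nat using (ℕ; zero; suc; _≤_; _^_)
open import Data.Fin using (Fin)
open import Data.Product using (Σ; ∃; _×_; _,_)
open import Data.Empty using (⊥)
open import Data.Unit using (⊤)
open import Relation.Nullary using (¬_; Dec; yes; no)
open import Relation.Binary.PropositionalEquality using (_≡_)
open import Function.Bundles using (_↔_)
open import Data.Nat.Primality using (Prime)

record Field : Set₁ where
  infixl 6 _+_
  infixl 7 _*_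
  field
    Carrier : Set
    _+_ _*_ : Carrier → Carrier → Carrier
    -_      : Carrier → Carrier
    0# 1#   : Carrier
    _≟_     : (x y : Carrier) → Dec (x ≡ y)
    +-assoc : ∀ x y z → (x + y) + z ≡ x + (y + z)
    +-comm  : ∀ x y → x + y ≡ y + x
    +-idˡ   : ∀ x → 0# + x ≡ x
    +-invˡ  : ∀ x → (- x) + x ≡ 0#
    *-assoc : ∀ x y z → (x * y) * z ≡ x * (y * z)
    *-comm  : ∀ x y → x * y ≡ y * x
    *-idˡ   : ∀ x → 1# * x ≡ x
    distribˡ : ∀ x y z → x * (y + z) ≡ (x * y) + (x * z)
    0≢1     : ¬ (0# ≡ 1#)
    *-inv   : ∀ x → ¬ (x ≡ 0#) → Σ Carrier λ y → y * x ≡ 1#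

module _ (F : Field) where
  open Field F

  record IsSubfield (K : Carrier → Set) : Set where
    field
      0∈ : K 0#
      1∈ : K 1#
      +∈ : ∀ {x y} → K x → K y → K (x + y)
      *∈ : ∀ {x y} → K x → K y → K (x * y)
      -∈ : ∀ {x} → K x → K (- x)
      inv∈ : ∀ {x y} → K x → y * x ≡ 1# → K y

  Σᶠ : ∀ {A : Set} → A → (A → A → A) → {n : ℕ} → (Fin n → A) → A
  Σᶠ z _⊕_ {zero} f = z
  Σᶠ z _⊕_ {suc n} f = f Fin.zero ⊕ Σᶠ z _⊕_ (λ i → f (Fin.suc i))

  ∑ : {n : ℕ} → (Fin n → Carrier) → Carrier
  ∑ = Σᶠ 0# _+_

  Vec : ℕ → Set
  Vec n = Fin n → Carrier

  0v : ∀ {n} → Vec n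
  0v _ = 0#

  _+v_ _-v_ : ∀ {n} → Vec n → Vec n → Vec n
  (x +v y) i = x i + y i
  (x -v y) i = x i + (- y i)

  _•_ : ∀ {n} → Carrier → Vec n → Vec n
  (a • x) i = a * x i

  _·_ : ∀ {n} → Vec n → Vec n → Carrier
  x · y = ∑ λ j → x j * y j

  -- Linear algebra over a subfield S (S = K for F_q-linearity,
  -- S = everything for F_{q^m}-linearity), in the vector space Vec t.

  lincomb : ∀ {t r} → (Fin r → Carrier) → (Fin r → Vec t) → Vec t
  lincomb {t} a v = Σᶠ 0v _+v_ (λ j → a j • v j)

  InSpan : (Carrier → Set) → ∀ {t r} → (Fin r → Vec t) → Vec t → Set
  InSpan S {r = r} v y = Σ (Fin r → Carrier) λ a → (∀ j → S (a j)) × (lincomb a v ≡ y)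

  LinIndep : (Carrier → Set) → ∀ {t r} → (Fin r → Vec t) → Set
  LinIndep S {r = r} v = (a : Fin r → Carrier) → (∀ j → S (a j)) →
                         lincomb a v ≡ 0v → ∀ j → a j ≡ 0#

  SpanDim : (Carrier → Set) → ∀ {t r} → (Fin r → Vec t) → ℕ → Set
  SpanDim S {t} {r} v d = Σ (Fin d → Vec t) λ b →
      LinIndep S b × (∀ j → InSpan S b (v j)) × (∀ i → InSpan S v (b i))

  AllF : Carrier → Set
  AllF _ = ⊤

  sc : Carrier → Vec 1
  sc a _ = a

  RankWeight : (K : Carrier → Set) → ∀ {N} → Vec N → ℕ → Set
  RankWeight K x w = SpanDim K (λ j → sc (x j)) w

  hammingWeight : ∀ {N} → Vec N → ℕ
  hammingWeight {zero} x = zero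
  hammingWeight {suc N} x with x Fin.zero ≟ 0#
  ... | yes _ = hammingWeight (λ i → x (Fin.suc i))
  ... | no _  = suc (hammingWeight (λ i → x (Fin.suc i)))

  HammingWeight : ∀ {N} → Vec N → ℕ → Set
  HammingWeight x w = w ≡ hammingWeight x

  -- covering radius of a code D ⊆ F^N (given as a predicate) w.r.t. a weight:
  -- ρ = max_x min_{c ∈ D} wt(x - c)
  CoveringRadius : ∀ {N} → (Vec N → ℕ → Set) → (Vec N → Set) → ℕ → Set
  CoveringRadius wt D ρ =
      (Σ (Vec _) λ x → ∀ c → D c → ∀ w → wt (x -v c) w → ρ ≤ w)
    × (∀ x → Σ (Vec _) λ c → D c × Σ ℕ λ w → wt (x -v c) w × w ≤ ρ)

  RowSpace : ∀ {k n} → (Fin k → Vec n) → Vec n → Set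
  RowSpace G c = InSpan AllF G c

  Dual : ∀ {n} → (Vec n → Set) → Vec n → Set
  Dual C y = ∀ c → C c → y · c ≡ 0#

  columns : ∀ {k n} → (Fin k → Vec n) → Fin n → Vec k
  columns G j i = G i j

  System : (K : Carrier → Set) → ∀ {k n} → (Fin k → Vec n) → Vec k → Set
  System K G u = InSpan K (columns G) u

  SamePoint : ∀ {k} → Vec k → Vec k → Set
  SamePoint u v = Σ Carrier λ λ' → ¬ (λ' ≡ 0#) × (u ≡ λ' • v)

  NonZeroV : ∀ {k} → Vec k → Set
  NonZeroV u = ¬ (u ≡ 0v)

  -- P : Fin N → F^k is a list of representatives, one for each point of L_U
  RepresentsLinearSet : ∀ {k} → (Vec k → Set) → ∀ {N} → (Fin N → Vec k) → Set
  RepresentsLinearSet U {N} P =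
      (∀ j → U (P j) × NonZeroV (P j))
    × (∀ u → U u → NonZeroV u → Σ (Fin N) λ j → SamePoint u (P j))
    × (∀ i j → SamePoint (P i) (P j) → i ≡ j)

  fromColumns : ∀ {k N} → (Fin N → Vec k) → Fin k → Vec N
  fromColumns P i j = P j i

module Submission where

-- Both covering radii can be computed coset by coset: ρ is the largest, over all syndromes, of the
-- least weight of a word with that syndrome (G-syndromes in F^n with rank weight, H-syndromes in
-- F^N with Hamming weight, where the columns of H represent the points of L_U).  So it suffices to
-- match syndromes without increasing weight, in both directions.
-- If e has rank weight r then e = β A with β ∈ F^r and A an r × n matrix over F_q; its G-syndrome
-- Σ_l e_l g_l is Σ_i β_i u_i with every u_i in U, and each nonzero u_i is a multiple of some point
-- representative P_j, so some z of Hamming weight ≤ r has the same H-syndrome.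
-- Conversely each P_j ∈ U is an F_q-combination of the columns g_l, so Σ_j z_j P_j = Σ_l e_l g_l
-- where all entries of e lie in the F_q-span of the nonzero z_j, whence rank(e) ≤ wt_H(z).
-- Both directions rest on the rank weight being the least number of elements whose F_q-span
-- contains the entries, i.e. on the exchange lemma (more rows than columns over F_q forces a
-- dependence), and on its existence, which uses that F_q is finite.

open import Level using (0ℓ)
open import Algebra.Bundles using (CommutativeRing)
open import Data.Empty using (⊥-elim)
open import Data.Fin using (Fin; zero; suc; punchIn; punchOut)
open import Data.Fin.Properties using (punchIn-punchOut; all?; any?; ¬∀⟶∃¬)
open import Data.Nat using (ℕ; zero; suc; _^_; _≤_; _<_; z≤n; s≤s; NonZero) renaming (_+_ to _+ᴺ_)
open import Data.Nat.Primality using (Prime)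
open import Data.Nat.Properties
  using (≤-trans; ≤-reflexive; ≮⇒≥; m≤n⇒m≤1+n; +-mono-≤; +-monoˡ-≤; +-commutativeSemigroup; module ≤-Reasoning)
open import Algebra.Properties.CommutativeSemigroup +-commutativeSemigroup
  using () renaming (interchange to +ᴺ-interchange)
open import Data.Product using (Σ; _×_; _,_; proj₁; proj₂)
open import Data.Vec.Functional using ([]; _∷_)
open import Data.Vec.Functional.Relation.Unary.All using (All)
open import Function.Bundles using (_↔_; _⇔_; mk⇔; Inverse; Equivalence)
open import Function.Construct.Composition using (_⇔-∘_)
open import Function.Construct.Symmetry using (⇔-sym)
open import Relation.Binary.PropositionalEquality
open import Relation.Nullary using (Dec; yes; no; ¬_)
open import Relation.Nullary.Decidable using (map′)
open import Defs

All-∷ : ∀ {A : Set} {P : A → Set} {n x} {xs : Fin n → A} → P x → All P xs → All P (x ∷ xs)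
All-∷ px _   zero    = px
All-∷ _  pxs (suc i) = pxs i

≗-punchIn : ∀ {A : Set} {n} {f g : Fin (suc n) → A} (i : Fin (suc n)) →
            f i ≡ g i → (∀ j → f (punchIn i j) ≡ g (punchIn i j)) → f ≗ g
≗-punchIn {f = f} {g} i fi≡gi f≗g j with i Data.Fin.≟ j
... | yes refl = fi≡gi
... | no  i≢j  = subst (λ m → f m ≡ g m) (punchIn-punchOut i≢j) (f≗g (punchOut i≢j))

module _ {A : Set} {P : A → Set} {q : ℕ} (enumerate : Fin q → Σ A P)
         (enumerate-onto : ∀ x → Σ (Fin q) λ i → enumerate i ≡ x) where

  ∃-vector? : ∀ d (Q : (Fin d → A) → Set) → (∀ {u v} → u ≗ v → Q u → Q v) → (∀ v → Dec (Q v)) →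
              Dec (Σ (Fin d → A) λ v → All P v × Q v)
  ∃-vector? zero Q Q-cong Q? =
    map′ (λ Q[] → [] , (λ ()) , Q[]) (λ (u , _ , Qu) → Q-cong (λ ()) Qu) (Q? [])
  ∃-vector? (suc d) Q Q-cong Q? = map′ from-head to-head (any? λ i →
      ∃-vector? d (λ v → Q (x i ∷ v)) (λ u≗v → Q-cong (λ { zero → refl ; (suc j) → u≗v j }))
                  (λ v → Q? (x i ∷ v)))
    where
    x : Fin q → A
    x i = proj₁ (enumerate i)

    from-head : (Σ (Fin q) λ i → Σ (Fin d → A) λ v → All P v × Q (x i ∷ v)) →
                Σ (Fin (suc d) → A) λ v → All P v × Q v
    from-head (i , v , v∈P , Qv) = x i ∷ v , All-∷ {P = P} (proj₂ (enumerate i)) v∈P , Qv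

    to-head : (Σ (Fin (suc d) → A) λ v → All P v × Q v) →
              Σ (Fin q) λ i → Σ (Fin d → A) λ v → All P v × Q (x i ∷ v)
    to-head (v , v∈P , Qv) =
      let (i , enum≡v₀) = enumerate-onto (v zero , v∈P zero)
      in i , (λ j → v (suc j)) , (λ j → v∈P (suc j)) ,
         Q-cong (λ { zero → sym (cong proj₁ enum≡v₀) ; (suc j) → refl }) Qv

module _ {C : Set} {k : ℕ} where

  CosetRadius : {A : Set} → (A → Fin k → C) → (A → ℕ → Set) → ℕ → Set
  CosetRadius {A} s wt ρ =
      (Σ A λ x → ∀ e → s e ≗ s x → ∀ w → wt e w → ρ ≤ w)
    × (∀ x → Σ A λ e → s e ≗ s x × Σ ℕ λ w → wt e w × w ≤ ρ)

  WeightBoundedTransfer : {A B : Set} → (A → Fin k → C) → (A → ℕ → Set) → (B → Fin k → C) → (B → ℕ → Set) →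
                          Set
  WeightBoundedTransfer {A} {B} sA wA sB wB =
    ∀ a w → wA a w → Σ B λ b → sB b ≗ sA a × Σ ℕ λ w′ → wB b w′ × w′ ≤ w

  Total : {A : Set} → (A → ℕ → Set) → Set
  Total {A} wt = ∀ a → Σ ℕ (wt a)

  private variable
    A B : Set
    sA : A → Fin k → C
    sB : B → Fin k → C
    wA : A → ℕ → Set
    wB : B → ℕ → Set

  transfer-partner : Total wA → WeightBoundedTransfer sA wA sB wB → ∀ a → Σ B λ b → sB b ≗ sA a
  transfer-partner total transfer a = let (b , sb≗sa , _) = transfer a _ (proj₂ (total a)) in b , sb≗sa

  cosetRadius-transfer : Total wA → Total wB →
                         WeightBoundedTransfer sA wA sB wB → WeightBoundedTransfer sB wB sA wA →
                         ∀ {ρ} → CosetRadius sA wA ρ → CosetRadius sB wB ρ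
  cosetRadius-transfer {wB = wB} {sB = sB} wA-total wB-total A⇒B B⇒A {ρ} ((x , x-far) , covers) =
    (y , y-far) , covers′
    where
    y = proj₁ (transfer-partner wA-total A⇒B x)
    sy≗sx = proj₂ (transfer-partner wA-total A⇒B x)

    y-far : ∀ e → sB e ≗ sB y → ∀ w → wB e w → ρ ≤ w
    y-far e se≗sy w e∶w =
      let (a , sa≗se , w′ , a∶w′ , w′≤w) = B⇒A e w e∶w
      in ≤-trans (x-far a (λ t → trans (sa≗se t) (trans (se≗sy t) (sy≗sx t))) w′ a∶w′) w′≤w

    covers′ : ∀ y → Σ _ λ e → sB e ≗ sB y × Σ ℕ λ w → wB e w × w ≤ ρ
    covers′ y =
      let (x , sx≗sy) = transfer-partner wB-total B⇒A y
          (e , se≗sx , w , e∶w , w≤ρ) = covers x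
          (f , sf≗se , w′ , f∶w′ , w′≤w) = A⇒B e w e∶w
      in f , (λ t → trans (sf≗se t) (trans (se≗sx t) (sx≗sy t))) , w′ , f∶w′ , ≤-trans w′≤w w≤ρ

  cosetRadius⇔ : Total wA → Total wB →
                 WeightBoundedTransfer sA wA sB wB → WeightBoundedTransfer sB wB sA wA →
                 ∀ {ρ} → CosetRadius sA wA ρ ⇔ CosetRadius sB wB ρ
  cosetRadius⇔ wA-total wB-total A⇒B B⇒A =
    mk⇔ (cosetRadius-transfer wA-total wB-total A⇒B B⇒A) (cosetRadius-transfer wB-total wA-total B⇒A A⇒B)

module _ (F : Field) where
  open Field F

  commutativeRing : CommutativeRing 0ℓ 0ℓ
  commutativeRing = record { isCommutativeRing = record
    { isRing = record
      { +-isAbelianGroup = record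
        { isGroup = record
          { isMonoid = record
            { isSemigroup = record
              { isMagma = record { isEquivalence = isEquivalence ; ∙-cong = cong₂ _+_ }
              ; assoc = +-assoc }
            ; identity = +-idˡ , λ x → trans (+-comm x 0#) (+-idˡ x) }
          ; inverse = +-invˡ , λ x → trans (+-comm x (- x)) (+-invˡ x)
          ; ⁻¹-cong = cong -_ }
        ; comm = +-comm }
      ; *-cong = cong₂ _*_
      ; *-assoc = *-assoc
      ; *-identity = *-idˡ , λ x → trans (*-comm x 1#) (*-idˡ x)
      ; distrib = distribˡ , λ x y z → trans (*-comm (y + z) x)
                    (trans (distribˡ x y z) (cong₂ _+_ (*-comm x y) (*-comm x z))) }
    ; *-comm = *-comm } }

module FieldAlgebra (F : Field) where
  open Field F public using (Carrier; _+_; _*_; -_; 0#; 1#; _≟_)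
  open CommutativeRing (commutativeRing F) public
    using (+-identityˡ; +-identityʳ; +-assoc; -‿inverseˡ; *-comm; *-assoc; *-identityˡ; *-identityʳ;
           zeroˡ; zeroʳ; distribˡ; distribʳ)
  open import Algebra.Properties.Ring (CommutativeRing.ring (commutativeRing F)) public
    using (-‿distribˡ-*; -‿distribʳ-*; -0#≈0#; -‿+-comm; ⁻¹-anti-homo‿-; xyx⁻¹≈y;
           x≈y⇒x∙y⁻¹≈ε; x∙y⁻¹≈ε⇒x≈y; +-inverseˡ-unique)
  open import Algebra.Properties.Semiring.Sum (CommutativeRing.semiring (commutativeRing F)) public
    using (sum; sum-cong-≗; ∑-distrib-+; ∑-comm; *-distribˡ-sum; *-distribʳ-sum; sum-replicate-zero)
  open ≡-Reasoning

  x≡0⇒x+y≡y : ∀ {x} y → x ≡ 0# → x + y ≡ y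
  x≡0⇒x+y≡y y refl = +-identityˡ y

  sub-sub-cancel : ∀ x e → x + - (x + - e) ≡ e
  sub-sub-cancel x e = begin
    x + - (x + - e) ≡⟨ cong (x +_) (⁻¹-anti-homo‿- x e) ⟩
    x + (e + - x)   ≡⟨ +-assoc x e (- x) ⟨
    x + e + - x     ≡⟨ xyx⁻¹≈y x e ⟩
    e               ∎

  ∑≡sum : ∀ {n} (f : Fin n → Carrier) → ∑ F f ≡ sum f
  ∑≡sum {zero}  f = refl
  ∑≡sum {suc n} f = cong (f zero +_) (∑≡sum (λ i → f (suc i)))

  ·≡sum : ∀ {n} (x y : Vec F n) → _·_ F x y ≡ sum (λ j → x j * y j)
  ·≡sum x y = ∑≡sum (λ j → x j * y j)

  sum-zero : ∀ {n} {f : Fin n → Carrier} → (∀ i → f i ≡ 0#) → sum f ≡ 0#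
  sum-zero {n} f≗0 = trans (sum-cong-≗ f≗0) (sum-replicate-zero n)

  sum-neg : ∀ {n} (f : Fin n → Carrier) → sum (λ i → - f i) ≡ - sum f
  sum-neg {zero}  f = sym -0#≈0#
  sum-neg {suc n} f = trans (cong (- f zero +_) (sum-neg (λ i → f (suc i)))) (-‿+-comm _ _)

  sum-mul-assoc : ∀ {m n} (x : Fin m → Carrier) (M : Fin m → Fin n → Carrier) (y : Fin n → Carrier) →
                  sum (λ i → x i * sum (λ l → M i l * y l)) ≡ sum (λ l → sum (λ i → x i * M i l) * y l)
  sum-mul-assoc x M y = begin
    sum (λ i → x i * sum (λ l → M i l * y l))
      ≡⟨ sum-cong-≗ (λ i → *-distribˡ-sum (x i) (λ l → M i l * y l)) ⟩
    sum (λ i → sum (λ l → x i * (M i l * y l)))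
      ≡⟨ ∑-comm (λ i l → x i * (M i l * y l)) ⟩
    sum (λ l → sum (λ i → x i * (M i l * y l)))
      ≡⟨ sum-cong-≗ (λ l → sum-cong-≗ (λ i → *-assoc (x i) (M i l) (y l))) ⟨
    sum (λ l → sum (λ i → x i * M i l * y l))
      ≡⟨ sum-cong-≗ (λ l → *-distribʳ-sum (y l) (λ i → x i * M i l)) ⟨
    sum (λ l → sum (λ i → x i * M i l) * y l) ∎

  δ : ∀ {n} → Fin n → Fin n → Carrier
  δ zero    zero    = 1#
  δ zero    (suc j) = 0#
  δ (suc i) zero    = 0#
  δ (suc i) (suc j) = δ i j

  sum-δ : ∀ {n} (p : Fin n) (f : Fin n → Carrier) → sum (λ i → δ p i * f i) ≡ f p
  sum-δ zero    f = trans (cong₂ _+_ (*-identityˡ (f zero)) (sum-zero {f = λ i → 0# * f (suc i)} (λ i → zeroˡ _)))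
                          (+-identityʳ (f zero))
  sum-δ (suc p) f = trans (x≡0⇒x+y≡y _ (zeroˡ (f zero))) (sum-δ p (λ i → f (suc i)))

  lincomb-eval : ∀ {t r} (a : Fin r → Carrier) (v : Fin r → Vec F t) (s : Fin t) →
                 lincomb F a v s ≡ sum (λ i → a i * v i s)
  lincomb-eval {r = zero}  a v s = refl
  lincomb-eval {r = suc r} a v s = cong (a zero * v zero s +_) (lincomb-eval (λ i → a (suc i)) (λ i → v (suc i)) s)

  lincomb-sc : ∀ {r} (a x : Fin r → Carrier) → lincomb F a (λ i → sc F (x i)) ≡ sc F (sum (λ i → a i * x i))
  lincomb-sc {zero}  a x = refl
  lincomb-sc {suc r} a x = cong (λ v i → a zero * x zero + v i) (lincomb-sc (λ i → a (suc i)) (λ i → x (suc i)))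

  lincomb-cong : ∀ {t r} (a : Fin r → Carrier) {v w : Fin r → Vec F t} → (∀ i → v i ≡ w i) →
                 lincomb F a v ≡ lincomb F a w
  lincomb-cong {r = zero}  a v≡w = refl
  lincomb-cong {r = suc r} a v≡w = cong₂ (_+v_ F) (cong (_•_ F (a zero)) (v≡w zero))
                                                  (lincomb-cong (λ i → a (suc i)) (λ i → v≡w (suc i)))

module HammingWeightProperties (F : Field) where
  open FieldAlgebra F
  open ≤-Reasoning

  indicator≢0 : Carrier → ℕ
  indicator≢0 a with a ≟ 0#
  ... | yes _ = 0
  ... | no  _ = 1

  indicator≢0≤1 : ∀ a → indicator≢0 a ≤ 1
  indicator≢0≤1 a with a ≟ 0#
  ... | yes _ = z≤n
  ... | no  _ = s≤s z≤n

  indicator≢0-zero : ∀ {a} → a ≡ 0# → indicator≢0 a ≡ 0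
  indicator≢0-zero refl with 0# ≟ 0#
  ... | yes _   = refl
  ... | no  0≢0 = ⊥-elim (0≢0 refl)

  indicator≢0-+ : ∀ a b → indicator≢0 (a + b) ≤ indicator≢0 a +ᴺ indicator≢0 b
  indicator≢0-+ a b with a ≟ 0#
  ... | yes refl = ≤-reflexive (cong indicator≢0 (+-identityˡ b))
  ... | no  _    with (a + b) ≟ 0#
  ...   | yes _ = z≤n
  ...   | no  _ = s≤s z≤n

  hammingWeight-suc : ∀ {N} (x : Vec F (suc N)) →
                      hammingWeight F x ≡ indicator≢0 (x zero) +ᴺ hammingWeight F (λ i → x (suc i))
  hammingWeight-suc x with x zero ≟ 0#
  ... | yes _ = refl
  ... | no  _ = refl

  hammingWeight-cong : ∀ {N} {x y : Vec F N} → x ≗ y → hammingWeight F x ≡ hammingWeight F y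
  hammingWeight-cong {zero}          _   = refl
  hammingWeight-cong {suc N} {x} {y} x≗y = trans (hammingWeight-suc x)
    (trans (cong₂ _+ᴺ_ (cong indicator≢0 (x≗y zero)) (hammingWeight-cong (λ i → x≗y (suc i))))
           (sym (hammingWeight-suc y)))

  hammingWeight-zero : ∀ {N} {x : Vec F N} → x ≗ 0v F → hammingWeight F x ≡ 0
  hammingWeight-zero {zero}      _   = refl
  hammingWeight-zero {suc N} {x} x≗0 = trans (hammingWeight-suc x)
    (cong₂ _+ᴺ_ (indicator≢0-zero (x≗0 zero)) (hammingWeight-zero (λ i → x≗0 (suc i))))

  hammingWeight-+ : ∀ {N} (x y : Vec F N) → hammingWeight F (_+v_ F x y) ≤ hammingWeight F x +ᴺ hammingWeight F y
  hammingWeight-+ {zero}  x y = z≤n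
  hammingWeight-+ {suc N} x y = begin
    hammingWeight F (_+v_ F x y)
      ≡⟨ hammingWeight-suc (_+v_ F x y) ⟩
    indicator≢0 (x₀ + y₀) +ᴺ hammingWeight F (_+v_ F x′ y′)
      ≤⟨ +-mono-≤ (indicator≢0-+ x₀ y₀) (hammingWeight-+ x′ y′) ⟩
    (indicator≢0 x₀ +ᴺ indicator≢0 y₀) +ᴺ (hammingWeight F x′ +ᴺ hammingWeight F y′)
      ≡⟨ +ᴺ-interchange (indicator≢0 x₀) _ _ _ ⟩
    (indicator≢0 x₀ +ᴺ hammingWeight F x′) +ᴺ (indicator≢0 y₀ +ᴺ hammingWeight F y′)
      ≡⟨ cong₂ _+ᴺ_ (hammingWeight-suc x) (hammingWeight-suc y) ⟨
    hammingWeight F x +ᴺ hammingWeight F y ∎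
    where
    x₀ = x zero
    y₀ = y zero
    x′ = λ i → x (suc i)
    y′ = λ i → y (suc i)

  hammingWeight-•δ≤1 : ∀ {N} (c : Carrier) (j : Fin N) → hammingWeight F (_•_ F c (δ j)) ≤ 1
  hammingWeight-•δ≤1 {suc N} c zero = begin
    hammingWeight F (_•_ F c (δ zero))
      ≡⟨ hammingWeight-suc (_•_ F c (δ zero)) ⟩
    indicator≢0 (c * 1#) +ᴺ hammingWeight F (λ (i : Fin N) → c * 0#)
      ≡⟨ cong (indicator≢0 (c * 1#) +ᴺ_) (hammingWeight-zero {N} (λ i → zeroʳ c)) ⟩
    indicator≢0 (c * 1#) +ᴺ 0
      ≤⟨ +-monoˡ-≤ 0 (indicator≢0≤1 (c * 1#)) ⟩
    1 ∎
  hammingWeight-•δ≤1 {suc N} c (suc j) = begin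
    hammingWeight F (_•_ F c (δ (suc j)))
      ≡⟨ hammingWeight-suc (_•_ F c (δ (suc j))) ⟩
    indicator≢0 (c * 0#) +ᴺ hammingWeight F (_•_ F c (δ j))
      ≡⟨ cong (_+ᴺ hammingWeight F (_•_ F c (δ j))) (indicator≢0-zero (zeroʳ c)) ⟩
    hammingWeight F (_•_ F c (δ j))
      ≤⟨ hammingWeight-•δ≤1 c j ⟩
    1 ∎

module Syndromes (F : Field) where
  open FieldAlgebra F
  open ≡-Reasoning

  syndrome : ∀ {k n} → (Fin k → Vec F n) → Vec F n → Vec F k
  syndrome M x t = _·_ F x (M t)

  syndrome-lincomb : ∀ {k n} (M : Fin k → Vec F n) (x : Vec F n) (a : Fin k → Carrier) →
                     _·_ F x (lincomb F a M) ≡ sum (λ t → a t * syndrome M x t)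
  syndrome-lincomb M x a = begin
    _·_ F x (lincomb F a M)
      ≡⟨ ·≡sum x (lincomb F a M) ⟩
    sum (λ j → x j * lincomb F a M j)
      ≡⟨ sum-cong-≗ (λ j → cong (x j *_) (trans (lincomb-eval a M j) (sum-cong-≗ (λ t → *-comm (a t) (M t j))))) ⟩
    sum (λ j → x j * sum (λ t → M t j * a t))
      ≡⟨ sum-mul-assoc x (λ j t → M t j) a ⟩
    sum (λ t → sum (λ j → x j * M t j) * a t)
      ≡⟨ sum-cong-≗ (λ t → trans (*-comm _ (a t)) (cong (a t *_) (sym (·≡sum x (M t))))) ⟩
    sum (λ t → a t * syndrome M x t) ∎

  syndrome-0v : ∀ {k n} (M : Fin k → Vec F n) t → syndrome M (0v F) t ≡ 0#
  syndrome-0v M t = trans (·≡sum (0v F) (M t)) (sum-zero (λ l → zeroˡ (M t l)))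

  syndrome-+ : ∀ {k n} (M : Fin k → Vec F n) (x y : Vec F n) t →
               syndrome M (_+v_ F x y) t ≡ syndrome M x t + syndrome M y t
  syndrome-+ M x y t = begin
    _·_ F (_+v_ F x y) (M t)                          ≡⟨ ·≡sum (_+v_ F x y) (M t) ⟩
    sum (λ l → (x l + y l) * M t l)                   ≡⟨ sum-cong-≗ (λ l → distribʳ (M t l) (x l) (y l)) ⟩
    sum (λ l → x l * M t l + y l * M t l)             ≡⟨ ∑-distrib-+ (λ l → x l * M t l) (λ l → y l * M t l) ⟩
    sum (λ l → x l * M t l) + sum (λ l → y l * M t l) ≡⟨ cong₂ _+_ (·≡sum x (M t)) (·≡sum y (M t)) ⟨
    syndrome M x t + syndrome M y t                   ∎

  syndrome-sub : ∀ {k n} (M : Fin k → Vec F n) (x y : Vec F n) t →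
                 syndrome M (_-v_ F x y) t ≡ syndrome M x t + - syndrome M y t
  syndrome-sub M x y t = begin
    _·_ F (_-v_ F x y) (M t)
      ≡⟨ ·≡sum (_-v_ F x y) (M t) ⟩
    sum (λ l → (x l + - y l) * M t l)
      ≡⟨ sum-cong-≗ (λ l → trans (distribʳ (M t l) (x l) (- y l))
                                 (cong (x l * M t l +_) (sym (-‿distribˡ-* (y l) (M t l))))) ⟩
    sum (λ l → x l * M t l + - (y l * M t l))
      ≡⟨ ∑-distrib-+ (λ l → x l * M t l) (λ l → - (y l * M t l)) ⟩
    sum (λ l → x l * M t l) + sum (λ l → - (y l * M t l))
      ≡⟨ cong (sum (λ l → x l * M t l) +_) (sum-neg (λ l → y l * M t l)) ⟩
    sum (λ l → x l * M t l) + - sum (λ l → y l * M t l)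
      ≡⟨ cong₂ (λ u v → u + - v) (·≡sum x (M t)) (·≡sum y (M t)) ⟨
    syndrome M x t + - syndrome M y t ∎

  syndrome-• : ∀ {k n} (M : Fin k → Vec F n) c (x : Vec F n) t → syndrome M (_•_ F c x) t ≡ c * syndrome M x t
  syndrome-• M c x t = begin
    _·_ F (_•_ F c x) (M t)            ≡⟨ ·≡sum (_•_ F c x) (M t) ⟩
    sum (λ l → c * x l * M t l)        ≡⟨ sum-cong-≗ (λ l → *-assoc c (x l) (M t l)) ⟩
    sum (λ l → c * (x l * M t l))      ≡⟨ *-distribˡ-sum c (λ l → x l * M t l) ⟨
    c * sum (λ l → x l * M t l)        ≡⟨ cong (c *_) (·≡sum x (M t)) ⟨
    c * syndrome M x t                 ∎

  syndrome-δ : ∀ {k n} (M : Fin k → Vec F n) (j : Fin n) t → syndrome M (δ j) t ≡ M t j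
  syndrome-δ M j t = trans (·≡sum (δ j) (M t)) (sum-δ j (M t))

  dual⇔syndrome≗0 : ∀ {k n} (M : Fin k → Vec F n) (c : Vec F n) →
                    Dual F (RowSpace F M) c ⇔ (syndrome M c ≗ 0v F)
  dual⇔syndrome≗0 M c = mk⇔ to from
    where
    to : Dual F (RowSpace F M) c → syndrome M c ≗ 0v F
    to c⊥ t = begin
      syndrome M c t                         ≡⟨ sum-δ t (syndrome M c) ⟨
      sum (λ t′ → δ t t′ * syndrome M c t′) ≡⟨ syndrome-lincomb M c (δ t) ⟨
      _·_ F c (lincomb F (δ t) M)            ≡⟨ c⊥ _ (δ t , _ , refl) ⟩
      0#                                     ∎

    from : syndrome M c ≗ 0v F → Dual F (RowSpace F M) c
    from s≗0 _ (a , _ , refl) =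
      trans (syndrome-lincomb M c a) (sum-zero (λ t → trans (cong (a t *_) (s≗0 t)) (zeroʳ (a t))))

  WeightCongruent : ∀ {N} → (Vec F N → ℕ → Set) → Set
  WeightCongruent wt = ∀ {x y} → x ≗ y → ∀ {w} → wt x w → wt y w

  coveringRadius⇔cosetRadius : ∀ {k n} {wt : Vec F n → ℕ → Set} → WeightCongruent wt →
                               (M : Fin k → Vec F n) (ρ : ℕ) →
                               CoveringRadius F wt (Dual F (RowSpace F M)) ρ ⇔ CosetRadius (syndrome M) wt ρ
  coveringRadius⇔cosetRadius {wt = wt} wt-cong M ρ = mk⇔ covering⇒coset coset⇒covering
    where
    _-_ = _-v_ F

    coset⇒dual : ∀ x e → syndrome M e ≗ syndrome M x → Dual F (RowSpace F M) (x - e)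
    coset⇒dual x e se≗sx = Equivalence.from (dual⇔syndrome≗0 M (x - e)) λ t →
      trans (syndrome-sub M x e t) (x≈y⇒x∙y⁻¹≈ε (sym (se≗sx t)))

    dual⇒coset : ∀ x c → Dual F (RowSpace F M) c → syndrome M (x - c) ≗ syndrome M x
    dual⇒coset x c c∈D t = begin
      syndrome M (x - c) t               ≡⟨ syndrome-sub M x c t ⟩
      syndrome M x t + - syndrome M c t  ≡⟨ cong (λ s → syndrome M x t + - s) sc≡0 ⟩
      syndrome M x t + - 0#              ≡⟨ cong (syndrome M x t +_) -0#≈0# ⟩
      syndrome M x t + 0#                ≡⟨ +-identityʳ _ ⟩
      syndrome M x t                     ∎
      where sc≡0 = Equivalence.to (dual⇔syndrome≗0 M c) c∈D t

    wt-sub-sub : ∀ x e {w} → wt e w → wt (x - (x - e)) w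
    wt-sub-sub x e = wt-cong (λ j → sym (sub-sub-cancel (x j) (e j)))

    covering⇒coset : CoveringRadius F wt (Dual F (RowSpace F M)) ρ → CosetRadius (syndrome M) wt ρ
    covering⇒coset ((x , x-far) , covers) =
        (x , λ e se≗sx w e∶w → x-far (x - e) (coset⇒dual x e se≗sx) w (wt-sub-sub x e e∶w))
      , λ y → let (c , c∈D , w , yc∶w , w≤ρ) = covers y in y - c , dual⇒coset y c c∈D , w , yc∶w , w≤ρ

    coset⇒covering : CosetRadius (syndrome M) wt ρ → CoveringRadius F wt (Dual F (RowSpace F M)) ρ
    coset⇒covering ((x , x-far) , covers) =
        (x , λ c c∈D w xc∶w → x-far (x - c) (dual⇒coset x c c∈D) w xc∶w)
      , λ y → let (e , se≗sy , w , e∶w , w≤ρ) = covers y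
              in y - e , coset⇒dual y e se≗sy , w , wt-sub-sub y e e∶w , w≤ρ

module Subfield (F : Field) {K : Field.Carrier F → Set} (K-subfield : IsSubfield F K) where
  open FieldAlgebra F
  open Field F using (*-inv; 0≢1)
  open IsSubfield K-subfield
  open ≡-Reasoning

  ∈K-sum : ∀ {n} {f : Fin n → Carrier} → All K f → K (sum f)
  ∈K-sum {zero}  _   = 0∈
  ∈K-sum {suc n} f∈K = +∈ (f∈K zero) (∈K-sum (λ i → f∈K (suc i)))

  ∈K-δ : ∀ {n} (i j : Fin n) → K (δ i j)
  ∈K-δ zero    zero    = 1∈
  ∈K-δ zero    (suc j) = 0∈
  ∈K-δ (suc i) zero    = 0∈
  ∈K-δ (suc i) (suc j) = ∈K-δ i j

  1≢0 : 1# ≢ 0#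
  1≢0 1≡0 = 0≢1 (sym 1≡0)

  NontrivialDependence : ∀ {r h} → (Fin r → Fin h → Carrier) → Set
  NontrivialDependence {r} C =
    Σ (Fin r → Carrier) λ a → All K a × (Σ (Fin r) λ i → a i ≢ 0#) × (∀ l → sum (λ i → a i * C i l) ≡ 0#)

  sum-sub-scaled : ∀ {r} (a x f : Fin r → Carrier) z →
                   sum (λ i → a i * (x i + - (f i * z))) ≡ sum (λ i → a i * x i) + - (sum (λ i → a i * f i) * z)
  sum-sub-scaled a x f z = begin
    sum (λ i → a i * (x i + - (f i * z)))
      ≡⟨ sum-cong-≗ (λ i → trans (distribˡ (a i) (x i) _) (cong (a i * x i +_) (sym (-‿distribʳ-* (a i) (f i * z))))) ⟩
    sum (λ i → a i * x i + - (a i * (f i * z)))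
      ≡⟨ ∑-distrib-+ (λ i → a i * x i) (λ i → - (a i * (f i * z))) ⟩
    sum (λ i → a i * x i) + sum (λ i → - (a i * (f i * z)))
      ≡⟨ cong (sum (λ i → a i * x i) +_) (sum-neg (λ i → a i * (f i * z))) ⟩
    sum (λ i → a i * x i) + - sum (λ i → a i * (f i * z))
      ≡⟨ cong (λ s → sum (λ i → a i * x i) + - s) (trans (sum-cong-≗ (λ i → sym (*-assoc (a i) (f i) z)))
                                                         (sym (*-distribʳ-sum z (λ i → a i * f i)))) ⟩
    sum (λ i → a i * x i) + - (sum (λ i → a i * f i) * z) ∎

  lift-row-reduction : ∀ {r h} (R₀ : Fin h → Carrier) (R : Fin r → Fin h → Carrier) (f a : Fin r → Carrier) →
                       (∀ m → sum (λ i → a i * (R i m + - (f i * R₀ m))) ≡ 0#) →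
                       ∀ m → sum (λ i → ((- sum (λ i → a i * f i)) ∷ a) i * (R₀ ∷ R) i m) ≡ 0#
  lift-row-reduction R₀ R f a reduced≡0 m = begin
    - s * R₀ m + sum (λ i → a i * R i m)   ≡⟨ cong (- s * R₀ m +_) (x∙y⁻¹≈ε⇒x≈y _ _ reduced′≡0) ⟩
    - s * R₀ m + s * R₀ m                  ≡⟨ cong (_+ s * R₀ m) (-‿distribˡ-* s (R₀ m)) ⟨
    - (s * R₀ m) + s * R₀ m                ≡⟨ -‿inverseˡ (s * R₀ m) ⟩
    0#                                     ∎
    where
    s = sum (λ i → a i * f i)
    reduced′≡0 : sum (λ i → a i * R i m) + - (s * R₀ m) ≡ 0#
    reduced′≡0 = trans (sym (sum-sub-scaled a (λ i → R i m) f (R₀ m))) (reduced≡0 m)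

  -- Gaussian elimination: clear column l₀ from the other rows using the pivot row 0; a dependence
  -- among the cleared rows, which vanish in column l₀, lifts to one among the rows of C.
  pivot-elimination : ∀ {r h} (C : Fin (suc r) → Fin (suc h) → Carrier) → (∀ i l → K (C i l)) →
                      (l₀ : Fin (suc h)) → C zero l₀ ≢ 0# →
                      ((D : Fin r → Fin h → Carrier) → (∀ i l → K (D i l)) → NontrivialDependence D) →
                      NontrivialDependence C
  pivot-elimination C C∈K l₀ pivot≢0 dependence =
    let (a , a∈K , (i₀ , aᵢ₀≢0) , a·E′≡0) =
          dependence (λ i l → E i (punchIn l₀ l)) (λ i l → E∈K i (punchIn l₀ l))
    in  (- sum (λ i → a i * f i)) ∷ a
      , All-∷ {P = K} (-∈ (∈K-sum (λ i → *∈ (a∈K i) (f∈K i)))) a∈K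
      , (suc i₀ , aᵢ₀≢0)
      , lift-row-reduction (C zero) (λ i → C (suc i)) f a (a·E≡0 a a·E′≡0)
    where
    y = proj₁ (*-inv (C zero l₀) pivot≢0)
    y*pivot≡1 = proj₂ (*-inv (C zero l₀) pivot≢0)
    f = λ i → C (suc i) l₀ * y
    f∈K = λ i → *∈ (C∈K (suc i) l₀) (inv∈ (C∈K zero l₀) y*pivot≡1)
    E = λ i m → C (suc i) m + - (f i * C zero m)
    E∈K = λ i m → +∈ (C∈K (suc i) m) (-∈ (*∈ (f∈K i) (C∈K zero m)))

    E-pivot≡0 : ∀ i → E i l₀ ≡ 0#
    E-pivot≡0 i = x≈y⇒x∙y⁻¹≈ε (sym (begin
      C (suc i) l₀ * y * C zero l₀   ≡⟨ *-assoc (C (suc i) l₀) y (C zero l₀) ⟩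
      C (suc i) l₀ * (y * C zero l₀) ≡⟨ cong (C (suc i) l₀ *_) y*pivot≡1 ⟩
      C (suc i) l₀ * 1#              ≡⟨ *-identityʳ (C (suc i) l₀) ⟩
      C (suc i) l₀                   ∎))

    a·E≡0 : ∀ a → (∀ l → sum (λ i → a i * E i (punchIn l₀ l)) ≡ 0#) → ∀ m → sum (λ i → a i * E i m) ≡ 0#
    a·E≡0 a a·E′≡0 = ≗-punchIn l₀ (sum-zero (λ i → trans (cong (a i *_) (E-pivot≡0 i)) (zeroʳ (a i)))) a·E′≡0

  more-rows⇒dependent : ∀ {h r} → h < r → (C : Fin r → Fin h → Carrier) → (∀ i l → K (C i l)) →
                        NontrivialDependence C
  more-rows⇒dependent {zero}  {suc r} _ C _ = (λ _ → 1#) , (λ _ → 1∈) , (zero , 1≢0) , λ ()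
  more-rows⇒dependent {suc h} {suc r} (s≤s h<r) C C∈K with all? (λ l → C zero l ≟ 0#)
  ... | yes row₀≡0 = δ zero , ∈K-δ zero , (zero , 1≢0) , λ l → trans (sum-δ zero (λ i → C i l)) (row₀≡0 l)
  ... | no  row₀≢0 = let (l₀ , pivot≢0) = ¬∀⟶∃¬ _ _ (λ l → C zero l ≟ 0#) row₀≢0
                     in pivot-elimination C C∈K l₀ pivot≢0 (more-rows⇒dependent h<r)

  InKSpan : ∀ {d} → (Fin d → Carrier) → Carrier → Set
  InKSpan {d} B y = Σ (Fin d → Carrier) λ a → All K a × sum (λ i → a i * B i) ≡ y

  KIndependent : ∀ {d} → (Fin d → Carrier) → Set
  KIndependent B = ∀ a → All K a → sum (λ i → a i * B i) ≡ 0# → ∀ i → a i ≡ 0#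

  InKSpan-self : ∀ {d} (B : Fin d → Carrier) j → InKSpan B (B j)
  InKSpan-self B j = δ j , ∈K-δ j , sum-δ j B

  InKSpan-suc : ∀ {d} (B : Fin (suc d) → Carrier) {y} → InKSpan (λ i → B (suc i)) y → InKSpan B y
  InKSpan-suc B (a , a∈K , a·B≡y) =
    0# ∷ a , All-∷ {P = K} 0∈ a∈K , trans (x≡0⇒x+y≡y _ (zeroˡ (B zero))) a·B≡y

  InKSpan-trans : ∀ {d n} {β : Fin d → Carrier} {e : Fin n → Carrier} → (∀ j → InKSpan β (e j)) →
                  ∀ {y} → InKSpan e y → InKSpan β y
  InKSpan-trans {β = β} {e} e∈⟨β⟩ {y} (a , a∈K , a·e≡y) =
    (λ l → sum (λ j → a j * c j l)) , (λ l → ∈K-sum (λ j → *∈ (a∈K j) (proj₁ (proj₂ (e∈⟨β⟩ j)) l))) , (begin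
      sum (λ l → sum (λ j → a j * c j l) * β l)   ≡⟨ sum-mul-assoc a c β ⟨
      sum (λ j → a j * sum (λ l → c j l * β l))   ≡⟨ sum-cong-≗ (λ j → cong (a j *_) (proj₂ (proj₂ (e∈⟨β⟩ j)))) ⟩
      sum (λ j → a j * e j)                       ≡⟨ a·e≡y ⟩
      y                                           ∎)
    where c = λ j → proj₁ (e∈⟨β⟩ j)

  independent-in-span⇒≤ : ∀ {r h} {γ : Fin r → Carrier} {β : Fin h → Carrier} →
                          KIndependent γ → (∀ i → InKSpan β (γ i)) → r ≤ h
  independent-in-span⇒≤ {r} {h} {γ} {β} γ-indep γ∈⟨β⟩ = ≮⇒≥ h≮r
    where
    C = λ i → proj₁ (γ∈⟨β⟩ i)
    h≮r : ¬ h < r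
    h≮r h<r =
      let (a , a∈K , (i , aᵢ≢0) , a·C≡0) = more-rows⇒dependent h<r C (λ i → proj₁ (proj₂ (γ∈⟨β⟩ i)))
      in aᵢ≢0 (γ-indep a a∈K (begin
        sum (λ i → a i * γ i)                      ≡⟨ sum-cong-≗ (λ i → cong (a i *_) (proj₂ (proj₂ (γ∈⟨β⟩ i)))) ⟨
        sum (λ i → a i * sum (λ l → C i l * β l))  ≡⟨ sum-mul-assoc a C β ⟩
        sum (λ l → sum (λ i → a i * C i l) * β l)  ≡⟨ sum-zero (λ l → trans (cong (_* β l) (a·C≡0 l)) (zeroˡ (β l))) ⟩
        0#                                         ∎) i)

  KIndependent-∷ : ∀ {d} {B : Fin d → Carrier} {v} → KIndependent B → ¬ InKSpan B v → KIndependent (v ∷ B)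
  KIndependent-∷ {B = B} {v} B-indep v∉⟨B⟩ a a∈K a·vB≡0 with a zero ≟ 0#
  ... | yes a₀≡0 = λ { zero → a₀≡0 ; (suc i) → a′≡0 i }
    where
    a′≡0 = B-indep (λ i → a (suc i)) (λ i → a∈K (suc i))
                   (trans (sym (x≡0⇒x+y≡y _ (trans (cong (_* v) a₀≡0) (zeroˡ v)))) a·vB≡0)
  ... | no a₀≢0 = ⊥-elim (v∉⟨B⟩ ((λ i → y * - a′ i) , (λ i → *∈ y∈K (-∈ (a∈K (suc i)))) , (begin
      sum (λ i → y * - a′ i * B i)     ≡⟨ sum-cong-≗ (λ i → *-assoc y (- a′ i) (B i)) ⟩
      sum (λ i → y * (- a′ i * B i))   ≡⟨ *-distribˡ-sum y (λ i → - a′ i * B i) ⟨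
      y * sum (λ i → - a′ i * B i)     ≡⟨ cong (y *_) (sum-cong-≗ (λ i → -‿distribˡ-* (a′ i) (B i))) ⟨
      y * sum (λ i → - (a′ i * B i))   ≡⟨ cong (y *_) (sum-neg (λ i → a′ i * B i)) ⟩
      y * - sum (λ i → a′ i * B i)     ≡⟨ cong (y *_) (+-inverseˡ-unique _ _ a·vB≡0) ⟨
      y * (a zero * v)                 ≡⟨ *-assoc y (a zero) v ⟨
      y * a zero * v                   ≡⟨ cong (_* v) (proj₂ (*-inv (a zero) a₀≢0)) ⟩
      1# * v                           ≡⟨ *-identityˡ v ⟩
      v                                ∎)))
    where
    a′ = λ i → a (suc i)
    y = proj₁ (*-inv (a zero) a₀≢0)
    y∈K = inv∈ (a∈K zero) (proj₂ (*-inv (a zero) a₀≢0))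

  KBasisOfEntries : ∀ {n} → (Fin n → Carrier) → ℕ → Set
  KBasisOfEntries e d =
    Σ (Fin d → Carrier) λ γ → KIndependent γ × (∀ j → InKSpan γ (e j)) × (∀ i → InKSpan e (γ i))

  -- RankWeight is phrased with the length-1 vectors sc x; this moves it to scalars.
  rankWeight⇔basis : ∀ {n} (e : Fin n → Carrier) r → RankWeight F K e r ⇔ KBasisOfEntries e r
  rankWeight⇔basis e r = mk⇔ to from
    where
    at₀ : ∀ {u v : Vec F 1} → u ≡ v → u zero ≡ v zero
    at₀ = cong (λ v → v zero)

    to : RankWeight F K e r → KBasisOfEntries e r
    to (b , b-indep , e∈⟨b⟩ , b∈⟨e⟩) = γ , γ-indep , (λ j → e∈⟨γ⟩ (e∈⟨b⟩ j)) , (λ i → c i , c∈K i , refl)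
      where
      c = λ i → proj₁ (b∈⟨e⟩ i)
      c∈K = λ i → proj₁ (proj₂ (b∈⟨e⟩ i))
      γ = λ i → sum (λ j → c i j * e j)

      b≡scγ : ∀ i → b i ≡ sc F (γ i)
      b≡scγ i = trans (sym (proj₂ (proj₂ (b∈⟨e⟩ i)))) (lincomb-sc (c i) e)

      γ-indep : KIndependent γ
      γ-indep a a∈K a·γ≡0 =
        b-indep a a∈K (trans (lincomb-cong a b≡scγ) (trans (lincomb-sc a γ) (cong (sc F) a·γ≡0)))

      e∈⟨γ⟩ : ∀ {y} → InSpan F K b (sc F y) → InKSpan γ y
      e∈⟨γ⟩ (a , a∈K , a·b≡y) =
        a , a∈K , at₀ (trans (sym (lincomb-sc a γ)) (trans (sym (lincomb-cong a b≡scγ)) a·b≡y))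

    from : KBasisOfEntries e r → RankWeight F K e r
    from (γ , γ-indep , e∈⟨γ⟩ , γ∈⟨e⟩) =
        (λ i → sc F (γ i))
      , (λ a a∈K a·γ≡0 → γ-indep a a∈K (at₀ (trans (sym (lincomb-sc a γ)) a·γ≡0)))
      , (λ j → span (e∈⟨γ⟩ j)) , (λ i → span (γ∈⟨e⟩ i))
      where
      span : ∀ {d} {B : Fin d → Carrier} {y} → InKSpan B y → InSpan F K (λ i → sc F (B i)) (sc F y)
      span {B = B} (a , a∈K , a·B≡y) = a , a∈K , trans (lincomb-sc a B) (cong (sc F) a·B≡y)

  EntriesSpannedBy : ∀ {n} → (Fin n → Carrier) → ℕ → Set
  EntriesSpannedBy e h = Σ (Fin h → Carrier) λ β → ∀ j → InKSpan β (e j)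

  rankWeight⇒spanned : ∀ {n} {e : Fin n → Carrier} {r} → RankWeight F K e r → EntriesSpannedBy e r
  rankWeight⇒spanned {e = e} {r} e∶r =
    let (γ , _ , e∈⟨γ⟩ , _) = Equivalence.to (rankWeight⇔basis e r) e∶r in γ , e∈⟨γ⟩

  rankWeight-least : ∀ {n} {e : Fin n → Carrier} {r h} → RankWeight F K e r → EntriesSpannedBy e h → r ≤ h
  rankWeight-least {e = e} {r} e∶r (β , e∈⟨β⟩) =
    let (γ , γ-indep , _ , γ∈⟨e⟩) = Equivalence.to (rankWeight⇔basis e r) e∶r
    in independent-in-span⇒≤ γ-indep (λ i → InKSpan-trans e∈⟨β⟩ (γ∈⟨e⟩ i))

  rankWeight-cong : ∀ {n} {e e′ : Fin n → Carrier} → e ≗ e′ → ∀ {r} → RankWeight F K e r → RankWeight F K e′ r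
  rankWeight-cong {e = e} {e′} e≗e′ {r} e∶r =
    let (γ , γ-indep , e∈⟨γ⟩ , γ∈⟨e⟩) = Equivalence.to (rankWeight⇔basis e r) e∶r
    in Equivalence.from (rankWeight⇔basis e′ r)
         ( γ , γ-indep
         , (λ j → let (a , a∈K , a·γ≡eⱼ) = e∈⟨γ⟩ j in a , a∈K , trans a·γ≡eⱼ (e≗e′ j))
         , (λ i → let (a , a∈K , a·e≡γᵢ) = γ∈⟨e⟩ i
                  in a , a∈K , trans (sum-cong-≗ (λ j → cong (a j *_) (sym (e≗e′ j)))) a·e≡γᵢ))

  module _ {q} (enumerate : Fin q → Σ Carrier K) (enumerate-onto : ∀ x → Σ (Fin q) λ i → enumerate i ≡ x) where

    InKSpan? : ∀ {d} (B : Fin d → Carrier) y → Dec (InKSpan B y)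
    InKSpan? {d} B y = ∃-vector? enumerate enumerate-onto d (λ a → sum (λ i → a i * B i) ≡ y)
      (λ a≗a′ a·B≡y → trans (sum-cong-≗ (λ i → cong (_* B i) (sym (a≗a′ i)))) a·B≡y)
      (λ a → sum (λ i → a i * B i) ≟ y)

    basis-exists : ∀ {n} (e : Fin n → Carrier) → Σ ℕ (KBasisOfEntries e)
    basis-exists {zero}  e = 0 , [] , (λ _ _ _ ()) , (λ ()) , (λ ())
    basis-exists {suc n} e with basis-exists (λ j → e (suc j))
    ... | d , γ , γ-indep , e′∈⟨γ⟩ , γ∈⟨e′⟩ with InKSpan? γ (e zero)
    ...   | yes e₀∈⟨γ⟩ = d , γ , γ-indep , (λ { zero → e₀∈⟨γ⟩ ; (suc j) → e′∈⟨γ⟩ j }) ,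
                         (λ i → InKSpan-suc e (γ∈⟨e′⟩ i))
    ...   | no  e₀∉⟨γ⟩ = suc d , e zero ∷ γ , KIndependent-∷ γ-indep e₀∉⟨γ⟩ ,
                         (λ { zero    → InKSpan-self (e zero ∷ γ) zero
                            ; (suc j) → InKSpan-suc (e zero ∷ γ) (e′∈⟨γ⟩ j) }) ,
                         (λ { zero → InKSpan-self e zero ; (suc i) → InKSpan-suc e (γ∈⟨e′⟩ i) })

    rankWeight-exists : ∀ {n} (e : Fin n → Carrier) → Σ ℕ (RankWeight F K e)
    rankWeight-exists e = let (d , basis) = basis-exists e in d , Equivalence.from (rankWeight⇔basis e d) basis

module LinearSetCode (F : Field) {K : Field.Carrier F → Set} (K-subfield : IsSubfield F K)
                     {k n N : ℕ} (G : Fin k → Vec F n) (P : Fin N → Vec F k)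
                     (P-represents : RepresentsLinearSet F (System F K G) P) where
  open FieldAlgebra F
  open Syndromes F
  open HammingWeightProperties F
  open Subfield F K-subfield
  open ≡-Reasoning

  H : Fin k → Vec F N
  H = fromColumns F P

  system-combination⇒hamming : ∀ h (β : Fin h → Carrier) (u : Fin h → Vec F k) → (∀ i → System F K G (u i)) →
                               Σ (Vec F N) λ z → hammingWeight F z ≤ h
                                               × (∀ t → syndrome H z t ≡ sum (λ i → β i * u i t))
  system-combination⇒hamming zero β u _ = 0v F , ≤-reflexive (hammingWeight-zero {N} (λ _ → refl)) , syndrome-0v H
  system-combination⇒hamming (suc h) β u u∈U
    with system-combination⇒hamming h (λ i → β (suc i)) (λ i → u (suc i)) (λ i → u∈U (suc i))
       | all? (λ t → u zero t ≟ 0#)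
  ... | z , z≤h , z≡βu′ | yes u₀≡0 =
    z , m≤n⇒m≤1+n z≤h ,
    λ t → trans (z≡βu′ t) (sym (x≡0⇒x+y≡y _ (trans (cong (β zero *_) (u₀≡0 t)) (zeroʳ (β zero)))))
  ... | z , z≤h , z≡βu′ | no u₀≢0 =
    let (j , λ₀ , _ , u₀≡λ₀Pⱼ) = proj₁ (proj₂ P-represents) (u zero) (u∈U zero)
                                   (λ u₀≡0 → u₀≢0 (λ t → cong (λ v → v t) u₀≡0))
        c = β zero * λ₀
    in  _+v_ F (_•_ F c (δ j)) z
      , ≤-trans (hammingWeight-+ (_•_ F c (δ j)) z) (+-mono-≤ (hammingWeight-•δ≤1 c j) z≤h)
      , λ t → begin
          syndrome H (_+v_ F (_•_ F c (δ j)) z) t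
            ≡⟨ syndrome-+ H (_•_ F c (δ j)) z t ⟩
          syndrome H (_•_ F c (δ j)) t + syndrome H z t
            ≡⟨ cong₂ _+_ (trans (syndrome-• H c (δ j) t) (cong (c *_) (syndrome-δ H j t))) (z≡βu′ t) ⟩
          β zero * λ₀ * P j t + βu′ t
            ≡⟨ cong (_+ βu′ t) (trans (*-assoc (β zero) λ₀ (P j t))
                                      (cong (β zero *_) (sym (cong (λ v → v t) u₀≡λ₀Pⱼ)))) ⟩
          β zero * u zero t + βu′ t ∎
    where βu′ = λ t → sum (λ i → β (suc i) * u (suc i) t)

  spanned⇒hamming : ∀ (e : Vec F n) {h} → EntriesSpannedBy e h →
                    Σ (Vec F N) λ z → hammingWeight F z ≤ h × syndrome H z ≗ syndrome G e
  spanned⇒hamming e {h} (β , e∈⟨β⟩) =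
    let (z , z≤h , z≡βu) = system-combination⇒hamming h β u (λ i → (λ l → A l i) , (λ l → A∈K l i) , refl)
    in z , z≤h , λ t → trans (z≡βu t) (βu≡syndrome t)
    where
    A = λ l → proj₁ (e∈⟨β⟩ l)
    A∈K = λ l → proj₁ (proj₂ (e∈⟨β⟩ l))

    u : Fin h → Vec F k
    u i = lincomb F (λ l → A l i) (columns F G)

    βu≡syndrome : ∀ t → sum (λ i → β i * u i t) ≡ syndrome G e t
    βu≡syndrome t = begin
      sum (λ i → β i * u i t)
        ≡⟨ sum-cong-≗ (λ i → cong (β i *_) (lincomb-eval (λ l → A l i) (columns F G) t)) ⟩
      sum (λ i → β i * sum (λ l → A l i * G t l))
        ≡⟨ sum-mul-assoc β (λ i l → A l i) (G t) ⟩
      sum (λ l → sum (λ i → β i * A l i) * G t l)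
        ≡⟨ sum-cong-≗ (λ l → cong (_* G t l)
                         (trans (sum-cong-≗ (λ i → *-comm (β i) (A l i))) (proj₂ (proj₂ (e∈⟨β⟩ l))))) ⟩
      sum (λ l → e l * G t l)
        ≡⟨ ·≡sum e (G t) ⟨
      syndrome G e t ∎

  combination⇒spanned : ∀ {M} (z : Vec F M) (Q : Fin M → Vec F k) → (∀ j → System F K G (Q j)) →
                        Σ (Vec F n) λ e → EntriesSpannedBy e (hammingWeight F z)
                                        × (∀ t → syndrome G e t ≡ sum (λ j → z j * Q j t))
  combination⇒spanned {zero}  z Q _ = 0v F , ([] , λ l → [] , (λ ()) , refl) , syndrome-0v G
  combination⇒spanned {suc M} z Q Q∈U
    with z zero ≟ 0# | combination⇒spanned (λ j → z (suc j)) (λ j → Q (suc j)) (λ j → Q∈U (suc j))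
  ... | yes z₀≡0 | e , spanned , e≡zQ′ =
    e , spanned , λ t → trans (e≡zQ′ t) (sym (x≡0⇒x+y≡y _ (trans (cong (_* Q zero t) z₀≡0) (zeroˡ (Q zero t)))))
  ... | no _ | e , (β , e∈⟨β⟩) , e≡zQ′ =
    let (α , α∈K , α·G≡Q₀) = Q∈U zero
    in  _+v_ F (_•_ F (z zero) α) e
      , (z zero ∷ β , λ l →
           let (a , a∈K , a·β≡eₗ) = e∈⟨β⟩ l
           in α l ∷ a , All-∷ {P = K} (α∈K l) a∈K , cong₂ _+_ (*-comm (α l) (z zero)) a·β≡eₗ)
      , λ t → begin
          syndrome G (_+v_ F (_•_ F (z zero) α) e) t
            ≡⟨ syndrome-+ G (_•_ F (z zero) α) e t ⟩
          syndrome G (_•_ F (z zero) α) t + syndrome G e t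
            ≡⟨ cong₂ _+_ (syndrome-• G (z zero) α t) (e≡zQ′ t) ⟩
          z zero * syndrome G α t + zQ′ t
            ≡⟨ cong (λ s → z zero * s + zQ′ t)
                    (trans (·≡sum α (G t)) (trans (sym (lincomb-eval α (columns F G) t)) (cong (λ v → v t) α·G≡Q₀))) ⟩
          z zero * Q zero t + zQ′ t ∎
    where zQ′ = λ t → sum (λ j → z (suc j) * Q (suc j) t)

  hamming⇒spanned : ∀ (z : Vec F N) →
                    Σ (Vec F n) λ e → EntriesSpannedBy e (hammingWeight F z) × syndrome G e ≗ syndrome H z
  hamming⇒spanned z =
    let (e , spanned , e≡zP) = combination⇒spanned z P (λ j → proj₁ (proj₁ P-represents j))
    in e , spanned , λ t → trans (e≡zP t) (sym (·≡sum z (H t)))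

  module _ {q} (enumerate : Fin q → Σ Carrier K) (enumerate-onto : ∀ x → Σ (Fin q) λ i → enumerate i ≡ x) where

    rank⇒hamming : WeightBoundedTransfer (syndrome G) (RankWeight F K) (syndrome H) (HammingWeight F)
    rank⇒hamming e r e∶r =
      let (z , z≤r , sz≗se) = spanned⇒hamming e (rankWeight⇒spanned e∶r)
      in z , sz≗se , hammingWeight F z , refl , z≤r

    hamming⇒rank : WeightBoundedTransfer (syndrome H) (HammingWeight F) (syndrome G) (RankWeight F K)
    hamming⇒rank z _ refl =
      let (e , spanned , se≗sz) = hamming⇒spanned z
          (r , e∶r) = rankWeight-exists enumerate enumerate-onto e
      in e , se≗sz , r , e∶r , rankWeight-least e∶r spanned

    coveringRadius-rank⇔hamming : ∀ ρ → CoveringRadius F (RankWeight F K) (Dual F (RowSpace F G)) ρ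
                                      ⇔ CoveringRadius F (HammingWeight F) (Dual F (RowSpace F H)) ρ
    coveringRadius-rank⇔hamming ρ =
      ⇔-sym (coveringRadius⇔cosetRadius HammingWeight-cong H ρ)
        ⇔-∘ (cosetRadius⇔ (rankWeight-exists enumerate enumerate-onto) (λ z → hammingWeight F z , refl)
                          rank⇒hamming hamming⇒rank
        ⇔-∘ coveringRadius⇔cosetRadius rankWeight-cong G ρ)
      where
      HammingWeight-cong : WeightCongruent (HammingWeight F {N})
      HammingWeight-cong x≗y w≡x = trans w≡x (hammingWeight-cong x≗y)

corollary2p6 : (F : Field) (K : Field.Carrier F → Set) →
    (q m n k : ℕ) → NonZero m → NonZero n → NonZero k →
    (Σ ℕ λ p → Σ ℕ λ e → Prime p × NonZero e × q ≡ p ^ e) →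
    IsSubfield F K →
    (Fin q ↔ Σ (Field.Carrier F) K) →
    (Fin (q ^ m) ↔ Field.Carrier F) →
    (G : Fin k → Vec F n) →
    LinIndep F (AllF F) G →
    SpanDim F K (columns F G) n →
    (N : ℕ) (P : Fin N → Vec F k) →
    RepresentsLinearSet F (System F K G) P →
    (ρ : ℕ) →
    CoveringRadius F (RankWeight F K) (Dual F (RowSpace F G)) ρ
      ⇔ CoveringRadius F (HammingWeight F) (Dual F (RowSpace F (fromColumns F P))) ρ
corollary2p6 F K q m n k _ _ _ _ K-subfield Fin-q↔K _ G _ _ N P P-represents =
  coveringRadius-rank⇔hamming (Inverse.to Fin-q↔K) (λ x → Inverse.from Fin-q↔K x , Inverse.inverseˡ Fin-q↔K refl)
  where open LinearSetCode F K-subfield G P P-represents
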